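{- Fix $b\in\{0,1\}^{\mathbb{N}}$ and a positive integer $N$. For $u=[u_0,\dots,u_{n-1}]\in\mathbb{N}^\ast$ and $x,y\in\mathbb{N}$ let $P(u,x,y):\equiv u_{n-1}<x\wedge((b_x=1\wedge x\le y)\to b_y=1)$, where for $u=[\,]$ the conjunct $u_{n-1}<x$ is omitted. For $v\in\mathbb{N}^\ast$ let $D(v):\equiv |v|=N\wedge\forall i\,(i+1<N\to(v_i<v_{i+1}\wedge b_{v_i}=b_{v_{i+1}}))$. For $\alpha\in\mathbb{N}^{\mathbb{N}}$ define: $f_1(\alpha):=$ the least $n<N$ such that $\neg(\alpha_{n-1}<\alpha_n)\vee b_{\alpha_n}=1$ (for $n=0$ the first disjunct is omitted), and $N-1$ if there is no such $n$; with $n:=f_1(\alpha)$, $f_2(\alpha):=$ the least $y$ with $\alpha_n\le y\le\alpha_n+N-1$ and $b_y=0$ if $b_{\alpha_n}=1$ and such $y$ exists, and $\alpha_n+N-1$ otherwise; $g(\alpha):=[\alpha_n,\alpha_n+1,\dots,\alpha_n+N-1]$ if $b_{\alpha_n}=1$, and $g(\alpha):=[\alpha_0,\dots,\alpha_{N-1}]$ otherwise. Then for every $\alpha\in\mathbb{N}^{\mathbb{N}}$: if $P(\overline{\alpha}f_1(\alpha),\alpha_{f_1(\alpha)},f_2(\alpha))$ holds then $D(g(\alpha))$ holds.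
   Context: $\mathbb{N}^\ast$ is the set of finite sequences of natural numbers, $[\,]$ the empty sequence, $|v|$ the length; for $\alpha\in\mathbb{N}^{\mathbb{N}}$, $\overline{\alpha}n:=[\alpha_0,\dots,\alpha_{n-1}]$. -}

module Defs where

open import Data.Nat using (ℕ; zero; suc; _+_; _∸_; _<_; _≤_; _<ᵇ_)
open import Data.Bool using (Bool; true; false; not; _∨_; if_then_else_)
open import Data.List using (List; []; _∷_; length; applyUpTo)
open import Data.Product using (_×_)
open import Data.Unit using (⊤)
open import Relation.Binary.PropositionalEquality using (_≡_)

prefix : (ℕ → ℕ) → ℕ → List ℕ
prefix α n = applyUpTo α n

-- i-th entry of a list (default 0 out of range; only used at in-range indices)
at : List ℕ → ℕ → ℕ
at []       _       = 0
at (x ∷ xs) zero    = x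
at (x ∷ xs) (suc i) = at xs i

LastLt : List ℕ → ℕ → Set
LastLt []           x = ⊤
LastLt (u ∷ [])     x = u < x
LastLt (u ∷ v ∷ us) x = LastLt (v ∷ us) x

P : (ℕ → Bool) → List ℕ → ℕ → ℕ → Set
P b u x y = LastLt u x × ((b x ≡ true × x ≤ y) → b y ≡ true)

D : (ℕ → Bool) → ℕ → List ℕ → Set
D b N v = length v ≡ N ×
  (∀ i → suc i < N → (at v i < at v (suc i)) × (b (at v i) ≡ b (at v (suc i))))

search : (ℕ → Bool) → (s k d : ℕ) → ℕ
search p s zero    d = d
search p s (suc k) d = if p s then s else search p (suc s) k d

f₁-cond : (ℕ → Bool) → (ℕ → ℕ) → ℕ → Bool
f₁-cond b α zero    = b (α zero)
f₁-cond b α (suc m) = not (α m <ᵇ α (suc m)) ∨ b (α (suc m))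

f₁ : (ℕ → Bool) → ℕ → (ℕ → ℕ) → ℕ
f₁ b N α = search (f₁-cond b α) 0 N (N ∸ 1)

f₂ : (ℕ → Bool) → ℕ → (ℕ → ℕ) → ℕ
f₂ b N α =
  if b (α (f₁ b N α))
  then search (λ y → not (b y)) (α (f₁ b N α)) N (α (f₁ b N α) + (N ∸ 1))
  else α (f₁ b N α) + (N ∸ 1)

g : (ℕ → Bool) → ℕ → (ℕ → ℕ) → List ℕ
g b N α =
  if b (α (f₁ b N α))
  then applyUpTo (λ j → α (f₁ b N α) + j) N
  else applyUpTo α N

module Submission where

-- Write n = f₁(α) and a = α n.  Everything rests on the specification
-- of the bounded linear search  search p s k d :  either it returns a hit r ≥ s with
-- p r = true, or p fails on the whole window s, s+1, …, s+k-1.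
--
-- * If b a = 1, then g(α) is the window [a, …, a+N-1] and f₂(α) is the search for a
--   zero of b on that window.  A hit r would satisfy a ≤ r and b r = 0, contradicting
--   the second conjunct of P.  So b is 1 on the whole window, and a window of
--   consecutive numbers on which b is constant satisfies D.
-- * If b a = 0, then g(α) = ᾱN.  A hit of the search defining f₁ at n, combined with
--   the first conjunct α_{n-1} < α_n of P, would force b a = 1.  So the f₁-condition
--   fails for every index below N: α is strictly increasing there and b ∘ α is 0,
--   whence D again.

open import Defs
open import Data.Nat using (ℕ; zero; suc; _+_; _∸_; _<_; _≤_; s≤s)
open import Data.Nat.Properties
  using (≤-refl; ≤-trans; n≤1+n; <-trans; +-identityʳ; n<1+n; +-suc; +-monoʳ-<; <ᵇ⇒<; <⇒<ᵇ)
open import Data.Bool using (Bool; true; false; not)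
open import Data.Bool.Properties using (T-≡; ∨-conicalˡ; ∨-conicalʳ; not-injective)
open import Data.List using (applyUpTo)
open import Data.List.Properties using (length-applyUpTo)
open import Data.Product using (_×_; _,_)
open import Data.Sum using (_⊎_; inj₁; inj₂)
open import Function.Bundles using (Equivalence)
open import Relation.Binary.PropositionalEquality using (_≡_; refl; sym; trans; subst; subst₂)

Hit : (ℕ → Bool) → ℕ → ℕ → Set
Hit p s r = s ≤ r × p r ≡ true

Miss : (ℕ → Bool) → ℕ → ℕ → Set
Miss p s k = ∀ i → i < k → p (s + i) ≡ false

search-spec : ∀ p s k d → Hit p s (search p s k d) ⊎ Miss p s k
search-spec p s zero    d = inj₂ λ i ()
search-spec p s (suc k) d with p s in ps
... | true  = inj₁ (≤-refl , ps)
... | false with search-spec p (suc s) k d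
...   | inj₁ (s<r , hit) = inj₁ (≤-trans (n≤1+n s) s<r , hit)
...   | inj₂ miss        = inj₂ miss-here
  where
  -- index 0 is s itself; index 1+i is index i of the window starting at s+1
  miss-here : Miss p s (suc k)
  miss-here zero    _         = subst (λ x → p x ≡ false) (sym (+-identityʳ s)) ps
  miss-here (suc i) (s≤s i<k) = subst (λ x → p x ≡ false) (sym (+-suc s i)) (miss i i<k)

at-applyUpTo : ∀ (f : ℕ → ℕ) n i → i < n → at (applyUpTo f n) i ≡ f i
at-applyUpTo f (suc n) zero    _         = refl
at-applyUpTo f (suc n) (suc i) (s≤s i<n) = at-applyUpTo (λ j → f (suc j)) n i i<n

D-applyUpTo : ∀ b N (f : ℕ → ℕ) (c : Bool) →
  (∀ i → suc i < N → f i < f (suc i)) → (∀ i → i < N → b (f i) ≡ c) →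
  D b N (applyUpTo f N)
D-applyUpTo b N f c increasing constant = length-applyUpTo f N , consecutive
  where
  consecutive : ∀ i → suc i < N →
    (at (applyUpTo f N) i < at (applyUpTo f N) (suc i)) ×
    (b (at (applyUpTo f N) i) ≡ b (at (applyUpTo f N) (suc i)))
  consecutive i si<N =
    subst₂ (λ u v → u < v × b u ≡ b v)
      (sym (at-applyUpTo f N i i<N)) (sym (at-applyUpTo f N (suc i) si<N))
      (increasing i si<N , trans (constant i i<N) (sym (constant (suc i) si<N)))
    where
    i<N : i < N
    i<N = <-trans (n<1+n i) si<N

D-window : ∀ b N a (c : Bool) → (∀ i → i < N → b (a + i) ≡ c) →
  D b N (applyUpTo (λ j → a + j) N)
D-window b N a c = D-applyUpTo b N (λ j → a + j) c (λ i _ → +-monoʳ-< a (n<1+n i))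

LastLt-prefix : ∀ (α : ℕ → ℕ) m x → LastLt (prefix α (suc m)) x → α m < x
LastLt-prefix α zero    x lt = lt
LastLt-prefix α (suc m) x lt = LastLt-prefix (λ j → α (suc j)) m x lt

cond-fails⇒b-false : ∀ b α m → f₁-cond b α m ≡ false → b (α m) ≡ false
cond-fails⇒b-false b α zero    fails = fails
cond-fails⇒b-false b α (suc m) fails = ∨-conicalʳ _ _ fails

cond-fails⇒increasing : ∀ b α m → f₁-cond b α (suc m) ≡ false → α m < α (suc m)
cond-fails⇒increasing b α m fails =
  <ᵇ⇒< (α m) (α (suc m))
    (Equivalence.from T-≡ (not-injective (∨-conicalˡ _ _ fails)))

cond-holds⇒b-true : ∀ b α m → f₁-cond b α m ≡ true →
  LastLt (prefix α m) (α m) → b (α m) ≡ true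
cond-holds⇒b-true b α zero    holds _ = holds
cond-holds⇒b-true b α (suc m) holds lt
  rewrite Equivalence.to T-≡ (<⇒<ᵇ (LastLt-prefix α m (α (suc m)) lt)) = holds

lemma6p2 : (b : ℕ → Bool) (N : ℕ) → 1 ≤ N → (α : ℕ → ℕ) →
    P b (prefix α (f₁ b N α)) (α (f₁ b N α)) (f₂ b N α) →
    D b N (g b N α)
lemma6p2 b N _ α (lt , one-stays-one) with b (α (f₁ b N α)) in ba
-- b a = 1: a zero of b in the window would contradict P, so b is 1 throughout.
... | true with search-spec (λ y → not (b y)) (α (f₁ b N α)) N (α (f₁ b N α) + (N ∸ 1))
...   | inj₂ no-zero = D-window b N (α (f₁ b N α)) true
                         (λ i i<N → not-injective (no-zero i i<N))
...   | inj₁ (a≤r , zero-at-r) rewrite one-stays-one (refl , a≤r) with zero-at-r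
...     | ()
-- b a = 0: a hit of f₁ at n would force b a = 1, so f₁ never hits below N.
lemma6p2 b N _ α (lt , _) | false with search-spec (f₁-cond b α) 0 N (N ∸ 1)
... | inj₁ (_ , holds) with trans (sym (cond-holds⇒b-true b α _ holds lt)) ba
...   | ()
lemma6p2 b N _ α (lt , _) | false | inj₂ never =
  D-applyUpTo b N α false
    (λ i si<N → cond-fails⇒increasing b α i (never (suc i) si<N))
    (λ i i<N → cond-fails⇒b-false b α i (never i i<N))
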